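{- Let $G$ be a connected edge-bicolored multigraph. Then any maximal red-blue bipartite subgraph of $G$ is connected.
   Context: An edge-bicolored multigraph has each edge colored red or blue, with possibly parallel edges (at most one red and one blue edge between any pair of vertices). It is connected if its underlying simple uncolored graph is connected. A subgraph $H$ of $G$ has $E(H)\subseteq E(G)$ and vertex set containing the endpoints of its edges; $H$ is red-blue bipartite if there is a bipartition $(X,Y)$ of its vertex set such that the set of edges of $H$ with one endpoint in $X$ and the other in $Y$ equals the set $B(H)$ of blue edges of $H$. It is a maximal red-blue bipartite subgraph if it is maximal under edge inclusion among red-blue bipartite subgraphs of $G$. -}

module Defs where

open import Data.Nat using (ℕ)
open import Data.Fin using (Fin)
open import Data.Bool using (Bool; true; false)
open import Data.Sum using (_⊎_)
open import Data.Product using (Σ; _×_; ∃)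
open import Relation.Binary.PropositionalEquality using (_≡_; _≢_)
open import Relation.Binary.Construct.Closure.ReflexiveTransitive using (Star)

-- Between two distinct vertices u, v there is at most one red edge
-- (present iff red u v ≡ true) and at most one blue edge
-- (present iff blue u v ≡ true).
record BiGraph (n : ℕ) : Set where
  field
    red      : Fin n → Fin n → Bool
    blue     : Fin n → Fin n → Bool
    red-sym  : ∀ u v → red u v ≡ red v u
    blue-sym : ∀ u v → blue u v ≡ blue v u
    red-irr  : ∀ u → red u u ≡ false
    blue-irr : ∀ u → blue u u ≡ false

open BiGraph public

Adj : ∀ {n} → BiGraph n → Fin n → Fin n → Set
Adj G u v = red G u v ≡ true ⊎ blue G u v ≡ true

Connected : ∀ {n} → BiGraph n → Set
Connected {n} G = ∀ (u v : Fin n) → Star (Adj G) u v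

record Subgraph {n : ℕ} (G : BiGraph n) : Set where
  field
    vert      : Fin n → Bool
    hred      : Fin n → Fin n → Bool
    hblue     : Fin n → Fin n → Bool
    hred-sym  : ∀ u v → hred u v ≡ hred v u
    hblue-sym : ∀ u v → hblue u v ≡ hblue v u
    hred⊆     : ∀ u v → hred u v ≡ true → red G u v ≡ true
    hblue⊆    : ∀ u v → hblue u v ≡ true → blue G u v ≡ true
    hred-end  : ∀ u v → hred u v ≡ true → vert u ≡ true
    hblue-end : ∀ u v → hblue u v ≡ true → vert u ≡ true

open Subgraph public

-- H is red-blue bipartite: there is a bipartition (X,Y) of V(H)
-- (X = vertices with side true, Y = side false) such that the edges of H
-- crossing (X,Y) are exactly the blue edges of H: red edges never cross,
-- blue edges always cross.
RedBlueBipartite : ∀ {n} {G : BiGraph n} → Subgraph G → Set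
RedBlueBipartite {n} H =
  Σ (Fin n → Bool) λ side →
    (∀ u v → hred H u v ≡ true → side u ≡ side v) ×
    (∀ u v → hblue H u v ≡ true → side u ≢ side v)

_⊆E_ : ∀ {n} {G : BiGraph n} → Subgraph G → Subgraph G → Set
H ⊆E H′ = (∀ u v → hred H u v ≡ true → hred H′ u v ≡ true) ×
          (∀ u v → hblue H u v ≡ true → hblue H′ u v ≡ true)

MaximalRedBlueBipartite : ∀ {n} {G : BiGraph n} → Subgraph G → Set
MaximalRedBlueBipartite {G = G} H =
  RedBlueBipartite H ×
  (∀ (H′ : Subgraph G) → RedBlueBipartite H′ → H ⊆E H′ → H′ ⊆E H)

HAdj : ∀ {n} {G : BiGraph n} → Subgraph G → Fin n → Fin n → Set
HAdj H u v = hred H u v ≡ true ⊎ hblue H u v ≡ true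

SubConnected : ∀ {n} {G : BiGraph n} → Subgraph G → Set
SubConnected {n} H =
  ∀ (u v : Fin n) → vert H u ≡ true → vert H v ≡ true → Star (HAdj H) u v

-- A maximal red-blue bipartite subgraph H contains a path between the ends
-- of every edge ab of G, so walks in G lift to walks in H.  Otherwise let C
-- be the component of a in H: switching the sides of all vertices of C keeps
-- the bipartition valid, and one of the two bipartitions (switched or not)
-- puts a and b on the sides the colour of ab demands.  Then H plus ab is
-- still red-blue bipartite, so by maximality ab is already in H.
module Submission where

open import Defs
open import Data.Nat using (ℕ; zero; suc; _≤_; _+_)
open import Data.Nat.Properties using (≤-trans; ≤-reflexive; ≤-antisym; +-suc; +-monoʳ-≤; m≤m+n)
open import Data.Fin using (Fin; _≟_)
open import Data.Fin.Properties using (any?)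
open import Data.Fin.Subset using (Subset; _∈_; _∉_; _∪_; ⁅_⁆; _⊂_; ∣_∣)
open import Data.Fin.Subset.Properties
  using (_∈?_; ∈⊤; x∈⁅x⁆; x∈⁅y⁆⇒x≡y; p⊆p∪q; x∈p∪q⁻; x∈p∪q⁺; ∣p∣≡n⇒p≡⊤; ∣p∣≤n; p⊂q⇒∣p∣<∣q∣)
open import Data.Bool using (Bool; true; false; _∨_; _xor_; not)
open import Data.Bool.Properties using (∨-zeroʳ; not-injective; not-¬)
import Data.Bool.Properties as Bool
open import Data.Sum using (_⊎_; inj₁; inj₂; [_,_]′)
open import Data.Product using (∃-syntax; ∃₂; _×_; _,_; proj₁; proj₂)
open import Data.Empty using (⊥-elim)
open import Function using (_∘_; mk⇔)
open import Level using (Level)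
open import Relation.Nullary using (Dec; yes; no; ¬_; does; map′)
open import Relation.Nullary.Decidable using (_×-dec_; _⊎-dec_; ¬?; dec-true; dec-false; does-⇔; decidable-stable)
open import Relation.Unary using (Pred)
import Relation.Unary as U
open import Relation.Binary using (Rel; _⇒_; Decidable; Symmetric; _Respects_)
open import Relation.Binary.PropositionalEquality using (_≡_; _≢_; refl; sym; trans; cong; cong₂; subst)
open import Relation.Binary.Construct.Closure.ReflexiveTransitive using (Star; ε; _◅_; _◅◅_; _⋆)

private
  variable
    ℓ : Level
    n : ℕ

dec-true⁻ : ∀ {A : Set ℓ} (a? : Dec A) → does a? ≡ true → A
dec-true⁻ (yes a) _ = a

∨-≡-trueˡ : ∀ {x} y → x ≡ true → x ∨ y ≡ true
∨-≡-trueˡ y refl = refl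

∨-≡-trueʳ : ∀ x {y} → y ≡ true → x ∨ y ≡ true
∨-≡-trueʳ x refl = ∨-zeroʳ x

∨-≡-true⁻ : ∀ x {y} → x ∨ y ≡ true → x ≡ true ⊎ y ≡ true
∨-≡-true⁻ true  _ = inj₁ refl
∨-≡-true⁻ false h = inj₂ h

xor-cancelˡ : ∀ c {x y} → c xor x ≡ c xor y → x ≡ y
xor-cancelˡ false eq = eq
xor-cancelˡ true  eq = not-injective eq

≢⇒not≡ : ∀ {x y} → x ≢ y → not x ≡ y
≢⇒not≡ {false} {false} x≢y = ⊥-elim (x≢y refl)
≢⇒not≡ {false} {true}  _   = refl
≢⇒not≡ {true}  {false} _   = refl
≢⇒not≡ {true}  {true}  x≢y = ⊥-elim (x≢y refl)

module _ {R : Rel (Fin n) ℓ} (R? : Decidable R) where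

  Closed : Subset n → Set ℓ
  Closed S = ∀ {x y} → x ∈ S → R x y → y ∈ S

  Leaving : Subset n → Set ℓ
  Leaving S = ∃₂ λ x y → x ∈ S × R x y × y ∉ S

  ReachableFrom : Fin n → Subset n → Set ℓ
  ReachableFrom u S = u ∈ S × (∀ {x} → x ∈ S → Star R u x)

  closed-⋆ : ∀ {S x y} → Closed S → x ∈ S → Star R x y → y ∈ S
  closed-⋆ closed x∈S ε          = x∈S
  closed-⋆ closed x∈S (xRz ◅ zy) = closed-⋆ closed (closed x∈S xRz) zy

  leaving? : (S : Subset n) → Dec (Leaving S)
  leaving? S = any? λ x → any? λ y → (x ∈? S) ×-dec R? x y ×-dec ¬? (y ∈? S)

  ¬leaving⇒closed : ∀ {S} → ¬ Leaving S → Closed S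
  ¬leaving⇒closed {S} ¬leave {x} {y} x∈S xRy =
    decidable-stable (y ∈? S) (λ y∉S → ¬leave (x , y , x∈S , xRy , y∉S))

  -- Each enlargement of S adds a vertex, so f + ∣ S ∣ ≥ n guarantees that
  -- the fuel f lasts until S is closed.
  grow : ∀ {u} f S → n ≤ f + ∣ S ∣ → ReachableFrom u S →
         ∃[ T ] ReachableFrom u T × Closed T
  grow f S bound reach with leaving? S
  ... | no ¬leave = S , reach , ¬leaving⇒closed ¬leave
  grow zero S bound _ | yes (_ , y , _ , _ , y∉S) =
    ⊥-elim (y∉S (subst (y ∈_) (sym (∣p∣≡n⇒p≡⊤ (≤-antisym (∣p∣≤n S) bound))) ∈⊤))
  grow (suc f) S bound (u∈S , reach) | yes (x , y , x∈S , xRy , y∉S) =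
    grow f (S ∪ ⁅ y ⁆) bound′ (p⊆p∪q ⁅ y ⁆ u∈S , reach′)
    where
    S⊂S∪y : S ⊂ S ∪ ⁅ y ⁆
    S⊂S∪y = p⊆p∪q ⁅ y ⁆ , y , x∈p∪q⁺ (inj₂ (x∈⁅x⁆ y)) , y∉S
    bound′ : n ≤ f + ∣ S ∪ ⁅ y ⁆ ∣
    bound′ = ≤-trans bound (≤-trans (≤-reflexive (sym (+-suc f ∣ S ∣)))
                                    (+-monoʳ-≤ f (p⊂q⇒∣p∣<∣q∣ S⊂S∪y)))
    reach′ : ∀ {z} → z ∈ S ∪ ⁅ y ⁆ → Star R _ z
    reach′ {z} z∈ with x∈p∪q⁻ S ⁅ y ⁆ z∈
    ... | inj₁ z∈S = reach z∈S
    ... | inj₂ z∈y = subst (Star R _) (sym (x∈⁅y⁆⇒x≡y y z∈y)) (reach x∈S ◅◅ xRy ◅ ε)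

  Star? : Decidable (Star R)
  Star? u v with grow n ⁅ u ⁆ (m≤m+n n _) (x∈⁅x⁆ u , from-u)
    where
    from-u : ∀ {x} → x ∈ ⁅ u ⁆ → Star R u x
    from-u x∈ = subst (Star R u) (sym (x∈⁅y⁆⇒x≡y u x∈)) ε
  ... | T , (u∈T , reach) , closed = map′ reach (closed-⋆ closed u∈T) (v ∈? T)

module _ {G : BiGraph n} where

  HAdj-sym : (H : Subgraph G) → Symmetric (HAdj H)
  HAdj-sym H {x} {y} (inj₁ r) = inj₁ (trans (hred-sym H y x) r)
  HAdj-sym H {x} {y} (inj₂ b) = inj₂ (trans (hblue-sym H y x) b)

  HAdj? : (H : Subgraph G) → Decidable (HAdj H)
  HAdj? H x y = (hred H x y Bool.≟ true) ⊎-dec (hblue H x y Bool.≟ true)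

  -- RedBlueBipartite H is definitionally Σ σ (Compatible H σ).
  Compatible : Subgraph G → (Fin n → Bool) → Set
  Compatible H σ = (∀ u v → hred H u v ≡ true → σ u ≡ σ v) ×
                   (∀ u v → hblue H u v ≡ true → σ u ≢ σ v)

  ⊆E-trans : {H K L : Subgraph G} → H ⊆E K → K ⊆E L → H ⊆E L
  ⊆E-trans (HK-red , HK-blue) (KL-red , KL-blue) =
    (λ u v → KL-red u v ∘ HK-red u v) , (λ u v → KL-blue u v ∘ HK-blue u v)

  _∪ᴱ_ : Subgraph G → Subgraph G → Subgraph G
  H ∪ᴱ K = record
    { vert      = λ x → vert H x ∨ vert K x
    ; hred      = λ x y → hred H x y ∨ hred K x y
    ; hblue     = λ x y → hblue H x y ∨ hblue K x y
    ; hred-sym  = λ x y → cong₂ _∨_ (hred-sym H x y) (hred-sym K x y)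
    ; hblue-sym = λ x y → cong₂ _∨_ (hblue-sym H x y) (hblue-sym K x y)
    ; hred⊆     = λ x y → [ hred⊆ H x y , hred⊆ K x y ]′ ∘ ∨-≡-true⁻ _
    ; hblue⊆    = λ x y → [ hblue⊆ H x y , hblue⊆ K x y ]′ ∘ ∨-≡-true⁻ _
    ; hred-end  = λ x y → [ ∨-≡-trueˡ _ ∘ hred-end H x y , ∨-≡-trueʳ _ ∘ hred-end K x y ]′
                          ∘ ∨-≡-true⁻ _
    ; hblue-end = λ x y → [ ∨-≡-trueˡ _ ∘ hblue-end H x y , ∨-≡-trueʳ _ ∘ hblue-end K x y ]′
                          ∘ ∨-≡-true⁻ _
    }

  ⊆E-∪ᴱˡ : (H K : Subgraph G) → H ⊆E (H ∪ᴱ K)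
  ⊆E-∪ᴱˡ H K = (λ u v → ∨-≡-trueˡ (hred K u v)) , (λ u v → ∨-≡-trueˡ (hblue K u v))

  ⊆E-∪ᴱʳ : (H K : Subgraph G) → K ⊆E (H ∪ᴱ K)
  ⊆E-∪ᴱʳ H K = (λ u v → ∨-≡-trueʳ (hred H u v)) , (λ u v → ∨-≡-trueʳ (hblue H u v))

  ∪ᴱ-compatible : ∀ {H K σ} → Compatible H σ → Compatible K σ → Compatible (H ∪ᴱ K) σ
  ∪ᴱ-compatible {H} {K} (H-red , H-blue) (K-red , K-blue) =
    (λ u v → [ H-red u v , K-red u v ]′ ∘ ∨-≡-true⁻ (hred H u v)) ,
    (λ u v → [ H-blue u v , K-blue u v ]′ ∘ ∨-≡-true⁻ (hblue H u v))

  maximal-absorbs : ∀ {H σ} → MaximalRedBlueBipartite H → Compatible H σ →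
                    (K : Subgraph G) → Compatible K σ → K ⊆E H
  maximal-absorbs {H} {σ} (_ , maximal) H-ok K K-ok =
    ⊆E-trans {K} {H ∪ᴱ K} {H} (⊆E-∪ᴱʳ H K) (maximal (H ∪ᴱ K) (σ , ∪ᴱ-compatible {H} {K} H-ok K-ok) (⊆E-∪ᴱˡ H K))

module _ (a b : Fin n) where

  SamePair : Fin n → Fin n → Set
  SamePair x y = (x ≡ a × y ≡ b) ⊎ (x ≡ b × y ≡ a)

  samePair? : Decidable SamePair
  samePair? x y = ((x ≟ a) ×-dec (y ≟ b)) ⊎-dec ((x ≟ b) ×-dec (y ≟ a))

  SamePair-sym : Symmetric SamePair
  SamePair-sym (inj₁ (x≡a , y≡b)) = inj₂ (y≡b , x≡a)
  SamePair-sym (inj₂ (x≡b , y≡a)) = inj₁ (y≡a , x≡b)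

  SamePair⇒ : ∀ {p} {P : Rel (Fin n) p} → Symmetric P → P a b → SamePair ⇒ P
  SamePair⇒ P-sym Pab (inj₁ (refl , refl)) = Pab
  SamePair⇒ P-sym Pab (inj₂ (refl , refl)) = P-sym Pab

  samePair-sym : ∀ x y → does (samePair? x y) ≡ does (samePair? y x)
  samePair-sym x y = does-⇔ (mk⇔ SamePair-sym SamePair-sym) (samePair? x y) (samePair? y x)

  isEnd? : U.Decidable (λ x → x ≡ a ⊎ x ≡ b)
  isEnd? x = (x ≟ a) ⊎-dec (x ≟ b)

  samePair-end : ∀ x y → does (samePair? x y) ≡ true → does (isEnd? x) ≡ true
  samePair-end x y same = dec-true (isEnd? x) (end (dec-true⁻ (samePair? x y) same))
    where
    end : SamePair x y → x ≡ a ⊎ x ≡ b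
    end (inj₁ (x≡a , _)) = inj₁ x≡a
    end (inj₂ (x≡b , _)) = inj₂ x≡b

module _ (G : BiGraph n) {a b : Fin n} where

  redEdge : red G a b ≡ true → Subgraph G
  redEdge r = record
    { vert      = λ x → does (isEnd? a b x)
    ; hred      = λ x y → does (samePair? a b x y)
    ; hblue     = λ _ _ → false
    ; hred-sym  = samePair-sym a b
    ; hblue-sym = λ _ _ → refl
    ; hred⊆     = λ x y → SamePair⇒ a b (λ {u} {v} → trans (red-sym G v u)) r
                          ∘ dec-true⁻ (samePair? a b x y)
    ; hblue⊆    = λ _ _ ()
    ; hred-end  = samePair-end a b
    ; hblue-end = λ _ _ ()
    }

  blueEdge : blue G a b ≡ true → Subgraph G
  blueEdge bl = record
    { vert      = λ x → does (isEnd? a b x)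
    ; hred      = λ _ _ → false
    ; hblue     = λ x y → does (samePair? a b x y)
    ; hred-sym  = λ _ _ → refl
    ; hblue-sym = samePair-sym a b
    ; hred⊆     = λ _ _ ()
    ; hblue⊆    = λ x y → SamePair⇒ a b (λ {u} {v} → trans (blue-sym G v u)) bl
                          ∘ dec-true⁻ (samePair? a b x y)
    ; hred-end  = λ _ _ ()
    ; hblue-end = samePair-end a b
    }

  redEdge-compatible : ∀ {σ} (r : red G a b ≡ true) → σ a ≡ σ b → Compatible (redEdge r) σ
  redEdge-compatible {σ} r σa≡σb =
    (λ x y → SamePair⇒ a b sym σa≡σb ∘ dec-true⁻ (samePair? a b x y)) , λ _ _ ()

  blueEdge-compatible : ∀ {σ} (bl : blue G a b ≡ true) → σ a ≢ σ b → Compatible (blueEdge bl) σ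
  blueEdge-compatible {σ} bl σa≢σb =
    (λ _ _ ()) , λ x y → SamePair⇒ a b (_∘ sym) σa≢σb ∘ dec-true⁻ (samePair? a b x y)

module _ {G : BiGraph n} (H : Subgraph G) {C : Pred (Fin n) ℓ}
         (C? : U.Decidable C) (C-closed : C Respects HAdj H) where

  flipOn : (Fin n → Bool) → Fin n → Bool
  flipOn σ x = does (C? x) xor σ x

  flipOn-compatible : ∀ {σ} → Compatible H σ → Compatible H (flipOn σ)
  flipOn-compatible {σ} (red-ok , blue-ok) =
    (λ x y r → cong₂ _xor_ (same-side (inj₁ r)) (red-ok x y r)) ,
    (λ x y b eq → blue-ok x y b
       (xor-cancelˡ (does (C? x)) (trans eq (cong (_xor σ y) (sym (same-side (inj₂ b)))))))
    where
    same-side : ∀ {x y} → HAdj H x y → does (C? x) ≡ does (C? y)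
    same-side h = does-⇔ (mk⇔ (C-closed h) (C-closed (HAdj-sym H h))) (C? _) (C? _)

  flipOn-inside : ∀ σ {x} → C x → flipOn σ x ≡ not (σ x)
  flipOn-inside σ {x} Cx = cong (_xor σ x) (dec-true (C? x) Cx)

  flipOn-outside : ∀ σ {x} → ¬ C x → flipOn σ x ≡ σ x
  flipOn-outside σ {x} ¬Cx = cong (_xor σ x) (dec-false (C? x) ¬Cx)

  module _ {σ} (σ-ok : Compatible H σ) {a b} (Ca : C a) (¬Cb : ¬ C b) where

    recolour-≡ : ∃[ τ ] Compatible H τ × τ a ≡ τ b
    recolour-≡ with σ a Bool.≟ σ b
    ... | yes σa≡σb = σ , σ-ok , σa≡σb
    ... | no  σa≢σb = flipOn σ , flipOn-compatible σ-ok ,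
      trans (flipOn-inside σ Ca) (trans (≢⇒not≡ σa≢σb) (sym (flipOn-outside σ ¬Cb)))

    recolour-≢ : ∃[ τ ] Compatible H τ × τ a ≢ τ b
    recolour-≢ with σ a Bool.≟ σ b
    ... | no  σa≢σb = σ , σ-ok , σa≢σb
    ... | yes σa≡σb = flipOn σ , flipOn-compatible σ-ok , λ eq →
      not-¬ (sym σa≡σb) (sym (trans (sym (flipOn-inside σ Ca)) (trans eq (flipOn-outside σ ¬Cb))))

module _ {G : BiGraph n} (H : Subgraph G) (maximal : MaximalRedBlueBipartite H) where

  maximal-joins-adjacent : Adj G ⇒ Star (HAdj H)
  maximal-joins-adjacent {a} {b} adj with Star? (HAdj? H) a b
  ... | yes path = path
  ... | no ¬path = ⊥-elim (¬path (edge-in-H adj ◅ ε))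
    where
    component-closed : Star (HAdj H) a Respects HAdj H
    component-closed h path = path ◅◅ h ◅ ε

    σ-ok : Compatible H (proj₁ (proj₁ maximal))
    σ-ok = proj₂ (proj₁ maximal)

    ab∈edge : does (samePair? a b a b) ≡ true
    ab∈edge = dec-true (samePair? a b a b) (inj₁ (refl , refl))

    edge-in-H : Adj G a b → HAdj H a b
    edge-in-H (inj₁ r) with recolour-≡ H (Star? (HAdj? H) a) component-closed σ-ok ε ¬path
    ... | τ , τ-ok , τa≡τb =
      inj₁ (proj₁ (maximal-absorbs {H = H} maximal τ-ok (redEdge G r) (redEdge-compatible G r τa≡τb)) a b ab∈edge)
    edge-in-H (inj₂ bl) with recolour-≢ H (Star? (HAdj? H) a) component-closed σ-ok ε ¬path
    ... | τ , τ-ok , τa≢τb =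
      inj₂ (proj₂ (maximal-absorbs {H = H} maximal τ-ok (blueEdge G bl) (blueEdge-compatible G bl τa≢τb)) a b ab∈edge)

lemma3 : ∀ (n : ℕ) (G : BiGraph n) → Connected G →
         ∀ (H : Subgraph G) → MaximalRedBlueBipartite H → SubConnected H
lemma3 n G connected H maximal u v _ _ = (maximal-joins-adjacent H maximal ⋆) (connected u v)
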